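{- Let $n\ge1$ be an integer and let $A\subseteq\mathbb{Z}_5^n$ be a subset with $|A|>0.3\cdot 5^n$. If $3A\ne\mathbb{Z}_5^n$, then for every subgroup $F$ of $\mathbb{Z}_5^n$ of index $5$, $A$ does not have non-empty intersection with exactly three cosets of $F$.
   Context: $\mathbb{Z}_5^n$ is the elementary abelian group of order $5^n$, written additively. $3A:=\{a_1+a_2+a_3\colon a_1,a_2,a_3\in A\}$. -}

module Defs where

open import Data.Nat using (ℕ; zero; suc; _+_; _∸_)
open import Data.Nat.DivMod using (_mod_)
open import Data.Fin using (Fin; toℕ)
open import Data.Vec using (Vec; []; _∷_; zipWith; replicate)
open import Data.List using (List; []; _∷_; allFin; concatMap; map)
open import Data.Bool using (Bool; true; false; T)
open import Data.Product using (∃-syntax; _×_)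
open import Relation.Binary.PropositionalEquality using (_≡_)
open import Relation.Nullary using (¬_)

ℤ₅ : Set
ℤ₅ = Fin 5

_+₅_ : ℤ₅ → ℤ₅ → ℤ₅
a +₅ b = (toℕ a + toℕ b) mod 5

-₅_ : ℤ₅ → ℤ₅
-₅ a = (5 ∸ toℕ a) mod 5

G : ℕ → Set
G n = Vec ℤ₅ n

_⊕_ : ∀ {n} → G n → G n → G n
_⊕_ = zipWith _+₅_

⊖_ : ∀ {n} → G n → G n
⊖ [] = []
⊖ (x ∷ xs) = (-₅ x) ∷ ⊖ xs

0G : ∀ {n} → G n
0G = replicate _ (0 mod 5)

_⊝_ : ∀ {n} → G n → G n → G n
x ⊝ y = x ⊕ (⊖ y)

allG : ∀ n → List (G n)
allG zero = [] ∷ []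
allG (suc n) = concatMap (λ a → map (a ∷_) (allG n)) (allFin 5)

Subset : ℕ → Set
Subset n = G n → Bool

countL : ∀ {n} → Subset n → List (G n) → ℕ
countL P [] = 0
countL P (x ∷ xs) with P x
... | true  = suc (countL P xs)
... | false = countL P xs

card : ∀ {n} → Subset n → ℕ
card {n} A = countL A (allG n)

_∈_ : ∀ {n} → G n → Subset n → Set
x ∈ A = T (A x)

3A-full : ∀ {n} → Subset n → Set
3A-full {n} A = (x : G n) → ∃[ a₁ ] ∃[ a₂ ] ∃[ a₃ ]
  (a₁ ∈ A × a₂ ∈ A × a₃ ∈ A × (a₁ ⊕ a₂) ⊕ a₃ ≡ x)

IsSubgroup : ∀ {n} → Subset n → Set
IsSubgroup {n} F = 0G ∈ F
  × ((x y : G n) → x ∈ F → y ∈ F → (x ⊕ y) ∈ F)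
  × ((x : G n) → x ∈ F → (⊖ x) ∈ F)

HasIndex5 : ∀ {n} → Subset n → Set
HasIndex5 {n} F = 5 Data.Nat.* card F ≡ 5 Data.Nat.^ n

SameCoset : ∀ {n} → Subset n → G n → G n → Set
SameCoset F x y = (x ⊝ y) ∈ F

MeetsExactlyThreeCosets : ∀ {n} → Subset n → Subset n → Set
MeetsExactlyThreeCosets {n} F A = ∃[ c₁ ] ∃[ c₂ ] ∃[ c₃ ]
  ( ¬ SameCoset F c₁ c₂ × ¬ SameCoset F c₁ c₃ × ¬ SameCoset F c₂ c₃
  × (∃[ a ] (a ∈ A × SameCoset F a c₁))
  × (∃[ a ] (a ∈ A × SameCoset F a c₂))
  × (∃[ a ] (a ∈ A × SameCoset F a c₃))
  × ((a : G n) → a ∈ A →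
       (SameCoset F a c₁ Data.Sum.⊎ SameCoset F a c₂) Data.Sum.⊎ SameCoset F a c₃))
  where import Data.Sum

{-# OPTIONS --safe #-}
-- Fix d ∉ F. As F has index 5, the cosets m·d + F (m ∈ ℤ₅) partition ℤ₅ⁿ, so every x has a label m
-- with x ∈ m·d + F, and labels are additive. Suppose A lies in three cosets with distinct labels
-- s₀, s₁, s₂, meeting A in slices of sizes a₀, a₁, a₂. Density gives 2(a₀ + a₁ + a₂) > 3|F|, so for
-- each l either the two other slices or slice l taken twice have total size > |F|. When
-- aᵢ + aₖ > |F|, pigeonhole inside the coset sᵢ puts the whole coset with label sᵢ + sₖ into A + A,
-- and adding an element of slice l reaches every x with label sᵢ + sₖ + sₗ. A finite check over ℤ₅
-- shows that these labels exhaust ℤ₅, whatever the three labels and whichever alternatives hold.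

module Submission where

open import Defs
open import Algebra.Bundles using (AbelianGroup)
open import Algebra.Structures using (IsAbelianGroup)
open import Data.Bool using (Bool; true; false; T; _∧_; _∨_)
open import Data.Bool.Properties using (T-≡; T-∧; T-∨)
open import Data.Empty using (⊥; ⊥-elim)
open import Data.Fin using (Fin; toℕ; zero; suc; inject₁; #_)
open import Data.Fin.Induction using (<-weakInduction)
open import Data.Fin.Properties using (all?; any?) renaming (_≟_ to _≟₅_)
open import Data.List using (List; []; _∷_; _++_; allFin; concatMap) renaming (map to mapₗ)
open import Data.List.Membership.Propositional using (lose) renaming (_∈_ to _∈ₗ_)
open import Data.List.Membership.Propositional.Properties using (∈-concatMap⁺; ∈-map⁺; ∈-allFin)
open import Data.List.Properties using (map-cong)
open import Data.List.Relation.Unary.All using (All; []; _∷_)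
open import Data.List.Relation.Unary.AllPairs using (AllPairs; []; _∷_)
import Data.List.Relation.Unary.AllPairs as AllPairs
open import Data.List.Relation.Unary.Any using (here; there)
open import Data.List.Relation.Unary.Unique.Propositional.Properties using (allFin⁺)
open import Data.Nat using (ℕ; zero; suc; _+_; _*_; _^_; _<_; _≤_; _≥_; _<?_; z≤n; s≤s; s≤s⁻¹)
open import Data.Nat.DivMod using (_mod_)
open import Data.Nat.ListAction using (sum)
open import Data.Nat.Properties
  using (≤-reflexive; ≤-trans; <-≤-trans; ≰⇒>; ≮⇒≥; n≮n; m≤m+n; m≤n⇒m≤1+n; +-suc; +-identityʳ;
         +-mono-≤; +-monoʳ-≤; *-monoʳ-≤; module ≤-Reasoning)
open import Data.Nat.Tactic.RingSolver using (solve-∀)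
open import Data.Product using (∃-syntax; _×_; _,_; proj₁; proj₂)
open import Data.Sum using (_⊎_; inj₁; inj₂; [_,_]′)
open import Data.Unit using (tt)
open import Data.Vec using ([]; _∷_; map)
open import Data.Vec.Properties
  using (zipWith-assoc; zipWith-comm; zipWith-identityˡ; zipWith-identityʳ; zipWith-inverseˡ; zipWith-inverseʳ)
open import Function.Bundles using (module Equivalence)
open import Relation.Binary.PropositionalEquality
  using (_≡_; refl; sym; trans; cong; cong₂; subst; subst₂; isEquivalence; module ≡-Reasoning)
open import Relation.Nullary using (¬_; Dec; yes; no)
open import Relation.Nullary.Decidable using (from-yes; decidable-stable; ¬?; _⊎-dec_; _→-dec_)

open Equivalence using (to; from)

_-₅_ : ℤ₅ → ℤ₅ → ℤ₅
a -₅ b = a +₅ (-₅ b)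

_·₅_ : ℤ₅ → ℤ₅ → ℤ₅
a ·₅ b = (toℕ a * toℕ b) mod 5

0₅ 1₅ : ℤ₅
0₅ = 0 mod 5
1₅ = suc zero

+₅-assoc : ∀ a b c → (a +₅ b) +₅ c ≡ a +₅ (b +₅ c)
+₅-assoc = from-yes (all? λ a → all? λ b → all? λ c → ((a +₅ b) +₅ c) ≟₅ (a +₅ (b +₅ c)))

+₅-comm : ∀ a b → a +₅ b ≡ b +₅ a
+₅-comm = from-yes (all? λ a → all? λ b → (a +₅ b) ≟₅ (b +₅ a))

+₅-identityˡ : ∀ a → 0₅ +₅ a ≡ a
+₅-identityˡ = from-yes (all? λ a → (0₅ +₅ a) ≟₅ a)

-₅-inverseˡ : ∀ a → (-₅ a) +₅ a ≡ 0₅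
-₅-inverseˡ = from-yes (all? λ a → ((-₅ a) +₅ a) ≟₅ 0₅)

+₅-identityʳ : ∀ a → a +₅ 0₅ ≡ a
+₅-identityʳ = from-yes (all? λ a → (a +₅ 0₅) ≟₅ a)

-₅-inverseʳ : ∀ a → a +₅ (-₅ a) ≡ 0₅
-₅-inverseʳ = from-yes (all? λ a → (a +₅ (-₅ a)) ≟₅ 0₅)

·₅-distribʳ-+₅ : ∀ a b x → (a +₅ b) ·₅ x ≡ (a ·₅ x) +₅ (b ·₅ x)
·₅-distribʳ-+₅ = from-yes (all? λ a → all? λ b → all? λ x → ((a +₅ b) ·₅ x) ≟₅ ((a ·₅ x) +₅ (b ·₅ x)))

·₅-assoc : ∀ a b x → (a ·₅ b) ·₅ x ≡ a ·₅ (b ·₅ x)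
·₅-assoc = from-yes (all? λ a → all? λ b → all? λ x → ((a ·₅ b) ·₅ x) ≟₅ (a ·₅ (b ·₅ x)))

·₅-neg : ∀ a x → (-₅ a) ·₅ x ≡ -₅ (a ·₅ x)
·₅-neg = from-yes (all? λ a → all? λ x → ((-₅ a) ·₅ x) ≟₅ (-₅ (a ·₅ x)))

·₅-identityˡ : ∀ x → 1₅ ·₅ x ≡ x
·₅-identityˡ = from-yes (all? λ x → (1₅ ·₅ x) ≟₅ x)

·₅-zeroˡ : ∀ x → 0₅ ·₅ x ≡ 0₅
·₅-zeroˡ = from-yes (all? λ x → (0₅ ·₅ x) ≟₅ 0₅)

-₅-≡0⇒≡ : ∀ a b → a -₅ b ≡ 0₅ → a ≡ b
-₅-≡0⇒≡ = from-yes (all? λ a → all? λ b → ((a -₅ b) ≟₅ 0₅) →-dec (a ≟₅ b))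

[s+t]-u≡t⇒u≡s : ∀ s t u → (s +₅ t) -₅ u ≡ t → u ≡ s
[s+t]-u≡t⇒u≡s = from-yes (all? λ s → all? λ t → all? λ u → (((s +₅ t) -₅ u) ≟₅ t) →-dec (u ≟₅ s))

[u+v]-v≡u : ∀ u v → (u +₅ v) -₅ v ≡ u
[u+v]-v≡u = from-yes (all? λ u → all? λ v → ((u +₅ v) -₅ v) ≟₅ u)

·₅-invertible : ∀ k → k ≡ 0₅ ⊎ ∃[ k⁻¹ ] k⁻¹ ·₅ k ≡ 1₅
·₅-invertible = from-yes (all? λ k → (k ≟₅ 0₅) ⊎-dec any? λ k⁻¹ → (k⁻¹ ·₅ k) ≟₅ 1₅)

suc≡1+inject₁ : ∀ (i : Fin 4) → suc i ≡ 1₅ +₅ inject₁ i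
suc≡1+inject₁ = from-yes (all? λ i → suc i ≟₅ (1₅ +₅ inject₁ i))

+₅-suc : ∀ (i : Fin 4) a → a +₅ suc i ≡ (a +₅ inject₁ i) +₅ 1₅
+₅-suc = from-yes (all? λ i → all? λ a → (a +₅ suc i) ≟₅ ((a +₅ inject₁ i) +₅ 1₅))

module AbelianGroupLemmas {a ℓ} (𝔾 : AbelianGroup a ℓ) where
  open AbelianGroup 𝔾
  open import Algebra.Properties.AbelianGroup 𝔾
  open import Algebra.Properties.CommutativeSemigroup commutativeSemigroup using (interchange)
  open import Relation.Binary.Reasoning.Setoid setoid

  [x-y]-[u-v]≈[x-u]-[y-v] : ∀ x y u v → (x - y) - (u - v) ≈ (x - u) - (y - v)
  [x-y]-[u-v]≈[x-u]-[y-v] x y u v = begin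
    (x - y) - (u - v)          ≈⟨ ∙-congˡ (⁻¹-anti-homo‿- u v) ⟩
    (x - y) ∙ (v - u)          ≈⟨ ∙-congˡ (comm v (u ⁻¹)) ⟩
    (x - y) ∙ (u ⁻¹ ∙ v)       ≈⟨ interchange x (y ⁻¹) (u ⁻¹) v ⟩
    (x - u) ∙ (y ⁻¹ ∙ v)       ≈⟨ ∙-congˡ (comm (y ⁻¹) v) ⟩
    (x - u) ∙ (v - y)          ≈⟨ ∙-congˡ (⁻¹-anti-homo‿- y v) ⟨
    (x - u) - (y - v)          ∎

  x∙[y-x]≈y : ∀ x y → x ∙ (y - x) ≈ y
  x∙[y-x]≈y x y = begin
    x ∙ (y - x)    ≈⟨ comm x (y - x) ⟩
    (y - x) ∙ x    ≈⟨ assoc y (x ⁻¹) x ⟩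
    y ∙ (x ⁻¹ ∙ x) ≈⟨ ∙-congˡ (inverseˡ x) ⟩
    y ∙ ε          ≈⟨ identityʳ y ⟩
    y              ∎

  [x-y]∙y≈x : ∀ x y → (x - y) ∙ y ≈ x
  [x-y]∙y≈x x y = begin
    (x - y) ∙ y    ≈⟨ comm (x - y) y ⟩
    y ∙ (x - y)    ≈⟨ x∙[y-x]≈y y x ⟩
    x              ∎

⊖-is-map : ∀ {n} (x : G n) → ⊖ x ≡ map -₅_ x
⊖-is-map []       = refl
⊖-is-map (a ∷ x) = cong (_ ∷_) (⊖-is-map x)

⊕-isAbelianGroup : ∀ n → IsAbelianGroup {A = G n} _≡_ _⊕_ 0G ⊖_
⊕-isAbelianGroup n = record
  { isGroup = record
    { isMonoid = record
      { isSemigroup = record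
        { isMagma = record { isEquivalence = isEquivalence ; ∙-cong = cong₂ _⊕_ }
        ; assoc = zipWith-assoc +₅-assoc
        }
      ; identity = zipWith-identityˡ +₅-identityˡ , zipWith-identityʳ +₅-identityʳ
      }
    ; inverse = (λ x → subst (λ y → y ⊕ x ≡ 0G) (sym (⊖-is-map x)) (zipWith-inverseˡ -₅-inverseˡ x))
              , (λ x → subst (λ y → x ⊕ y ≡ 0G) (sym (⊖-is-map x)) (zipWith-inverseʳ -₅-inverseʳ x))
    ; ⁻¹-cong = cong ⊖_
    }
  ; comm = zipWith-comm +₅-comm
  }

ℤ₅ⁿ : ℕ → AbelianGroup _ _
ℤ₅ⁿ n = record { isAbelianGroup = ⊕-isAbelianGroup n }

infix 25 _·_
_·_ : ∀ {n} → ℤ₅ → G n → G n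
k · x = map (k ·₅_) x

·-distribʳ : ∀ {n} a b (x : G n) → (a +₅ b) · x ≡ a · x ⊕ b · x
·-distribʳ a b []      = refl
·-distribʳ a b (c ∷ x) = cong₂ _∷_ (·₅-distribʳ-+₅ a b c) (·-distribʳ a b x)

·-neg : ∀ {n} a (x : G n) → (-₅ a) · x ≡ ⊖ (a · x)
·-neg a []      = refl
·-neg a (c ∷ x) = cong₂ _∷_ (·₅-neg a c) (·-neg a x)

·-assoc : ∀ {n} a b (x : G n) → (a ·₅ b) · x ≡ a · (b · x)
·-assoc a b []      = refl
·-assoc a b (c ∷ x) = cong₂ _∷_ (·₅-assoc a b c) (·-assoc a b x)

·-identity : ∀ {n} (x : G n) → 1₅ · x ≡ x
·-identity []      = refl
·-identity (c ∷ x) = cong₂ _∷_ (·₅-identityˡ c) (·-identity x)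

·-zero : ∀ {n} (x : G n) → 0₅ · x ≡ 0G
·-zero []      = refl
·-zero (c ∷ x) = cong₂ _∷_ (·₅-zeroˡ c) (·-zero x)

_⊆_ : ∀ {n} → Subset n → Subset n → Set
P ⊆ Q = ∀ x → x ∈ P → x ∈ Q

_∪_ _∩_ : ∀ {n} → Subset n → Subset n → Subset n
(P ∪ Q) x = P x ∨ Q x
(P ∩ Q) x = P x ∧ Q x

Disjoint : ∀ {n} → Subset n → Subset n → Set
Disjoint P Q = ∀ x → x ∈ P → x ∈ Q → ⊥

module _ {n : ℕ} where

  countL-cong : ∀ {P Q : Subset n} → (∀ x → P x ≡ Q x) → ∀ xs → countL P xs ≡ countL Q xs
  countL-cong {P} {Q} P≗Q []       = refl
  countL-cong {P} {Q} P≗Q (x ∷ xs) with P x | Q x | P≗Q x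
  ... | true  | .true  | refl = cong suc (countL-cong P≗Q xs)
  ... | false | .false | refl = countL-cong P≗Q xs

  countL-mono : ∀ {P Q : Subset n} → P ⊆ Q → ∀ xs → countL P xs ≤ countL Q xs
  countL-mono {P} {Q} P⊆Q []       = z≤n
  countL-mono {P} {Q} P⊆Q (x ∷ xs) with P x in Px | Q x in Qx
  ... | true  | true  = s≤s (countL-mono P⊆Q xs)
  ... | true  | false = ⊥-elim (subst T Qx (P⊆Q x (from T-≡ Px)))
  ... | false | true  = m≤n⇒m≤1+n (countL-mono P⊆Q xs)
  ... | false | false = countL-mono P⊆Q xs

  countL-∪-∩ : ∀ (P Q : Subset n) xs →
    countL P xs + countL Q xs ≡ countL (P ∪ Q) xs + countL (P ∩ Q) xs
  countL-∪-∩ P Q []       = refl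
  countL-∪-∩ P Q (x ∷ xs) with P x | Q x
  ... | true  | true  = cong suc (trans (+-suc _ _) (trans (cong suc (countL-∪-∩ P Q xs)) (sym (+-suc _ _))))
  ... | true  | false = cong suc (countL-∪-∩ P Q xs)
  ... | false | true  = trans (+-suc _ _) (cong suc (countL-∪-∩ P Q xs))
  ... | false | false = countL-∪-∩ P Q xs

  countL-witness : ∀ (P : Subset n) xs → 0 < countL P xs → ∃[ x ] x ∈ P
  countL-witness P (x ∷ xs) pos with P x in Px
  ... | true  = x , from T-≡ Px
  ... | false = countL-witness P xs pos

  countL-complete : ∀ (P : Subset n) xs → countL (λ _ → true) xs ≤ countL P xs →
    ∀ {x} → x ∈ₗ xs → x ∈ P
  countL-complete P (y ∷ xs) full {x} x∈ with P y in Py | x∈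
  ... | true  | here refl = from T-≡ Py
  ... | true  | there x∈xs = countL-complete P xs (s≤s⁻¹ full) x∈xs
  ... | false | _ = ⊥-elim (n≮n _ (<-≤-trans full (countL-mono (λ _ _ → tt) xs)))

  countL-none : ∀ (P : Subset n) xs → (∀ x → ¬ x ∈ P) → countL P xs ≡ 0
  countL-none P []       none = refl
  countL-none P (x ∷ xs) none with P x in Px
  ... | true  = ⊥-elim (none x (from T-≡ Px))
  ... | false = countL-none P xs none

  card-cong : ∀ {P Q : Subset n} → (∀ x → P x ≡ Q x) → card P ≡ card Q
  card-cong P≗Q = countL-cong P≗Q (allG n)

  card-mono : ∀ {P Q : Subset n} → P ⊆ Q → card P ≤ card Q
  card-mono P⊆Q = countL-mono P⊆Q (allG n)

  card-∪ : ∀ (P Q : Subset n) → card (P ∪ Q) ≤ card P + card Q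
  card-∪ P Q = subst (card (P ∪ Q) ≤_) (sym (countL-∪-∩ P Q (allG n))) (m≤m+n _ _)

  card-∪-disjoint : ∀ (P Q : Subset n) → Disjoint P Q → card (P ∪ Q) ≡ card P + card Q
  card-∪-disjoint P Q P∩Q≡∅ = begin
    card (P ∪ Q)                  ≡⟨ +-identityʳ _ ⟨
    card (P ∪ Q) + 0              ≡⟨ cong (card (P ∪ Q) +_) (countL-none (P ∩ Q) (allG n) none) ⟨
    card (P ∪ Q) + card (P ∩ Q)   ≡⟨ countL-∪-∩ P Q (allG n) ⟨
    card P + card Q               ∎
    where
    open ≡-Reasoning
    none : ∀ x → ¬ x ∈ (P ∩ Q)
    none x x∈P∩Q = let x∈P , x∈Q = to T-∧ x∈P∩Q in P∩Q≡∅ x x∈P x∈Q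

  pigeonhole : ∀ {P Q R : Subset n} → (P ∪ Q) ⊆ R → card R < card P + card Q →
    ∃[ x ] (x ∈ P × x ∈ Q)
  pigeonhole {P} {Q} {R} P∪Q⊆R R<P+Q = split (countL-witness (P ∩ Q) (allG n) ∩-nonempty)
    where
    ∩-nonempty : 0 < card (P ∩ Q)
    ∩-nonempty = ≰⇒> λ ∩≤0 → n≮n (card R) (<-≤-trans R<P+Q (begin
      card P + card Q              ≡⟨ countL-∪-∩ P Q (allG n) ⟩
      card (P ∪ Q) + card (P ∩ Q)  ≤⟨ +-mono-≤ (card-mono P∪Q⊆R) ∩≤0 ⟩
      card R + 0                   ≡⟨ +-identityʳ (card R) ⟩
      card R                       ∎))
      where open ≤-Reasoning
    split : ∃[ x ] x ∈ (P ∩ Q) → ∃[ x ] (x ∈ P × x ∈ Q)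
    split (x , x∈P∩Q) = x , to T-∧ x∈P∩Q

  countL-++ : ∀ (P : Subset n) xs ys → countL P (xs ++ ys) ≡ countL P xs + countL P ys
  countL-++ P []       ys = refl
  countL-++ P (x ∷ xs) ys with P x
  ... | true  = cong suc (countL-++ P xs ys)
  ... | false = countL-++ P xs ys

  countL-map : ∀ {m} (P : Subset n) (f : G m → G n) xs → countL P (mapₗ f xs) ≡ countL (λ x → P (f x)) xs
  countL-map P f []       = refl
  countL-map P f (x ∷ xs) with P (f x)
  ... | true  = cong suc (countL-map P f xs)
  ... | false = countL-map P f xs

allG-complete : ∀ {n} (x : G n) → x ∈ₗ allG n
allG-complete []      = here refl
allG-complete (a ∷ x) = ∈-concatMap⁺ (λ b → mapₗ (b ∷_) (allG _)) (lose (∈-allFin a) (∈-map⁺ (a ∷_) (allG-complete x)))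

card-complete : ∀ {n} (P : Subset n) → card {n} (λ _ → true) ≤ card P → ∀ x → x ∈ P
card-complete {n} P full x = countL-complete P (allG n) full (allG-complete x)

∑ : (ℤ₅ → ℕ) → ℕ
∑ g = sum (mapₗ g (allFin 5))

countL-concatMap-∷ : ∀ {n} (P : Subset (suc n)) (xs : List (G n)) as →
  countL P (concatMap (λ a → mapₗ (a ∷_) xs) as) ≡ sum (mapₗ (λ a → countL (λ x → P (a ∷ x)) xs) as)
countL-concatMap-∷ P xs []       = refl
countL-concatMap-∷ P xs (a ∷ as) = trans (countL-++ P (mapₗ (a ∷_) xs) _)
  (cong₂ _+_ (countL-map P (a ∷_) xs) (countL-concatMap-∷ P xs as))

card-∷ : ∀ {n} (P : Subset (suc n)) → card P ≡ ∑ (λ a → card (λ x → P (a ∷ x)))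
card-∷ {n} P = countL-concatMap-∷ P (allG n) (allFin 5)

∑-cong : ∀ {g h : ℤ₅ → ℕ} → (∀ a → g a ≡ h a) → ∑ g ≡ ∑ h
∑-cong g≗h = cong sum (map-cong g≗h (allFin 5))

∑-rotate : ∀ (g : ℤ₅ → ℕ) → ∑ (λ a → g (a +₅ 1₅)) ≡ ∑ g
∑-rotate g = rotate (g (# 0)) (g (# 1)) (g (# 2)) (g (# 3)) (g (# 4))
  where
  rotate : ∀ a b c d e → b + (c + (d + (e + (a + 0)))) ≡ a + (b + (c + (d + (e + 0))))
  rotate = solve-∀

∑-shift : ∀ b (g : ℤ₅ → ℕ) → ∑ (λ a → g (a +₅ b)) ≡ ∑ g
∑-shift = <-weakInduction (λ b → ∀ g → ∑ (λ a → g (a +₅ b)) ≡ ∑ g) (λ g → refl) step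
  where
  step : ∀ i → (∀ g → ∑ (λ a → g (a +₅ inject₁ i)) ≡ ∑ g) → ∀ g → ∑ (λ a → g (a +₅ suc i)) ≡ ∑ g
  step i shift g = begin
    ∑ (λ a → g (a +₅ suc i))                ≡⟨ ∑-cong (λ a → cong g (+₅-suc i a)) ⟩
    ∑ (λ a → g ((a +₅ inject₁ i) +₅ 1₅))    ≡⟨ shift (λ c → g (c +₅ 1₅)) ⟩
    ∑ (λ c → g (c +₅ 1₅))                   ≡⟨ ∑-rotate g ⟩
    ∑ g                                      ∎
    where open ≡-Reasoning

∑-neg : ∀ (g : ℤ₅ → ℕ) → ∑ (λ a → g (-₅ a)) ≡ ∑ g
∑-neg g = reverse (g (# 0)) (g (# 1)) (g (# 2)) (g (# 3)) (g (# 4))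
  where
  reverse : ∀ a b c d e → a + (e + (d + (c + (b + 0)))) ≡ a + (b + (c + (d + (e + 0))))
  reverse = solve-∀

card-⊕ : ∀ {n} (P : Subset n) (t : G n) → card (λ x → P (x ⊕ t)) ≡ card P
card-⊕ {zero}  P []      = card-cong {0} {λ x → P (x ⊕ [])} {P} λ { [] → refl }
card-⊕ {suc n} P (b ∷ t) = begin
  card (λ x → P (x ⊕ (b ∷ t)))                  ≡⟨ card-∷ (λ x → P (x ⊕ (b ∷ t))) ⟩
  ∑ (λ a → card (λ x → P ((a +₅ b) ∷ (x ⊕ t)))) ≡⟨ ∑-cong (λ a → card-⊕ (λ x → P ((a +₅ b) ∷ x)) t) ⟩
  ∑ (λ a → card (λ x → P ((a +₅ b) ∷ x)))       ≡⟨ ∑-shift b (λ c → card (λ x → P (c ∷ x))) ⟩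
  ∑ (λ c → card (λ x → P (c ∷ x)))              ≡⟨ card-∷ P ⟨
  card P                                         ∎
  where open ≡-Reasoning

card-⊖ : ∀ {n} (P : Subset n) → card (λ x → P (⊖ x)) ≡ card P
card-⊖ {zero}  P = card-cong {0} {λ x → P (⊖ x)} {P} λ { [] → refl }
card-⊖ {suc n} P = begin
  card (λ x → P (⊖ x))                          ≡⟨ card-∷ (λ x → P (⊖ x)) ⟩
  ∑ (λ a → card (λ x → P ((-₅ a) ∷ ⊖ x)))       ≡⟨ ∑-cong (λ a → card-⊖ (λ x → P ((-₅ a) ∷ x))) ⟩
  ∑ (λ a → card (λ x → P ((-₅ a) ∷ x)))         ≡⟨ ∑-neg (λ c → card (λ x → P (c ∷ x))) ⟩
  ∑ (λ c → card (λ x → P (c ∷ x)))              ≡⟨ card-∷ P ⟨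
  card P                                         ∎
  where open ≡-Reasoning

card-⊤ : ∀ n → card {n} (λ _ → true) ≡ 5 ^ n
card-⊤ zero    = refl
card-⊤ (suc n) = trans (card-∷ {n} (λ _ → true)) (cong (λ c → ∑ (λ _ → c)) (card-⊤ n))

card-reflect : ∀ {n} (P : Subset n) (y : G n) → card (λ x → P (y ⊝ x)) ≡ card P
card-reflect {n} P y = begin
  card (λ x → P (y ⊝ x))        ≡⟨ card-cong (λ x → cong P (comm y (⊖ x))) ⟩
  card (λ x → P ((⊖ x) ⊕ y))    ≡⟨ card-⊖ (λ x → P (x ⊕ y)) ⟩
  card (λ x → P (x ⊕ y))        ≡⟨ card-⊕ P y ⟩
  card P                         ∎
  where
  open ≡-Reasoning
  open AbelianGroup (ℤ₅ⁿ n) using (comm)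

⋃ : ∀ {n} {I : Set} → (I → Subset n) → List I → Subset n
⋃ S []       x = false
⋃ S (i ∷ is) x = S i x ∨ ⋃ S is x

module _ {n : ℕ} {I : Set} (S : I → Subset n) where

  ∈-⋃⁻ : ∀ is {x} → x ∈ ⋃ S is → ∃[ i ] x ∈ S i
  ∈-⋃⁻ (i ∷ is) {x} x∈⋃ with to (T-∨ {S i x}) x∈⋃
  ... | inj₁ x∈Si = i , x∈Si
  ... | inj₂ x∈⋃′ = ∈-⋃⁻ is x∈⋃′

  ⋃-disjoint : ∀ {P} is → All (λ j → Disjoint P (S j)) is → Disjoint P (⋃ S is)
  ⋃-disjoint (j ∷ is) (P∩Sj≡∅ ∷ rest) x x∈P x∈⋃ with to (T-∨ {S j x}) x∈⋃
  ... | inj₁ x∈Sj = P∩Sj≡∅ x x∈P x∈Sj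
  ... | inj₂ x∈⋃′ = ⋃-disjoint is rest x x∈P x∈⋃′

  card-⋃-disjoint : ∀ is → AllPairs (λ i j → Disjoint (S i) (S j)) is →
    card (⋃ S is) ≡ sum (mapₗ (λ i → card (S i)) is)
  card-⋃-disjoint []       _ = countL-none (⋃ S []) (allG n) (λ _ ())
  card-⋃-disjoint (i ∷ is) (disj ∷ pairwise) =
    trans (card-∪-disjoint (S i) (⋃ S is) (⋃-disjoint is disj))
          (cong (card (S i) +_) (card-⋃-disjoint is pairwise))

  ∈-⋃⁺ : ∀ {i is x} → i ∈ₗ is → x ∈ S i → x ∈ ⋃ S is
  ∈-⋃⁺ {x = x} (here refl)  x∈Si = from T-∨ (inj₁ x∈Si)
  ∈-⋃⁺ {is = j ∷ _} {x} (there i∈is) x∈Si = from (T-∨ {S j x}) (inj₂ (∈-⋃⁺ i∈is x∈Si))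

  card-⋃ : ∀ is → card (⋃ S is) ≤ sum (mapₗ (λ i → card (S i)) is)
  card-⋃ []       = ≤-reflexive (countL-none (⋃ S []) (allG n) (λ _ ()))
  card-⋃ (i ∷ is) = ≤-trans (card-∪ (S i) (⋃ S is)) (+-monoʳ-≤ (card (S i)) (card-⋃ is))

module Cosets {n : ℕ} (F : Subset n) (F-subgroup : IsSubgroup F) (d : G n) (d∉F : ¬ d ∈ F) where

  open AbelianGroup (ℤ₅ⁿ n) using (identityˡ; identityʳ; inverseʳ)
  open import Algebra.Properties.AbelianGroup (ℤ₅ⁿ n) using (ε⁻¹≈ε; ⁻¹-involutive)
  open AbelianGroupLemmas (ℤ₅ⁿ n) using ([x-y]-[u-v]≈[x-u]-[y-v]; x∙[y-x]≈y)
  open ≡-Reasoning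

  0∈F : 0G ∈ F
  0∈F = proj₁ F-subgroup

  ⊕-closed : ∀ {x y} → x ∈ F → y ∈ F → (x ⊕ y) ∈ F
  ⊕-closed = proj₁ (proj₂ F-subgroup) _ _

  ⊖-closed : ∀ {x} → x ∈ F → (⊖ x) ∈ F
  ⊖-closed = proj₂ (proj₂ F-subgroup) _

  ·-closed : ∀ k {x} → x ∈ F → k · x ∈ F
  ·-closed = <-weakInduction (λ k → ∀ {x} → x ∈ F → k · x ∈ F) zero-case suc-case
    where
    zero-case : ∀ {x} → x ∈ F → 0₅ · x ∈ F
    zero-case {x} _ = subst (_∈ F) (sym (·-zero x)) 0∈F
    suc-case : ∀ i → (∀ {x} → x ∈ F → inject₁ i · x ∈ F) → ∀ {x} → x ∈ F → suc i · x ∈ F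
    suc-case i ih {x} x∈F = subst (_∈ F) (sym unfold) (⊕-closed x∈F (ih x∈F))
      where
      unfold : suc i · x ≡ x ⊕ inject₁ i · x
      unfold = begin
        suc i · x                   ≡⟨ cong (_· x) (suc≡1+inject₁ i) ⟩
        (1₅ +₅ inject₁ i) · x       ≡⟨ ·-distribʳ 1₅ (inject₁ i) x ⟩
        1₅ · x ⊕ inject₁ i · x      ≡⟨ cong (_⊕ inject₁ i · x) (·-identity x) ⟩
        x ⊕ inject₁ i · x           ∎

  Coset : ℤ₅ → Subset n
  Coset m x = F (x ⊝ m · d)

  Coset-0 : ∀ x → Coset 0₅ x ≡ F x
  Coset-0 x = cong F (begin
    x ⊝ 0₅ · d    ≡⟨ cong (λ y → x ⊕ (⊖ y)) (·-zero d) ⟩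
    x ⊕ (⊖ 0G)    ≡⟨ cong (x ⊕_) ε⁻¹≈ε ⟩
    x ⊕ 0G        ≡⟨ identityʳ x ⟩
    x             ∎)

  Coset-⊝ : ∀ {m m′ x y} → x ∈ Coset m → y ∈ Coset m′ → (x ⊝ y) ∈ Coset (m -₅ m′)
  Coset-⊝ {m} {m′} {x} {y} x∈ y∈ = subst (_∈ F) (sym regroup) (⊕-closed x∈ (⊖-closed y∈))
    where
    regroup : (x ⊝ y) ⊝ (m -₅ m′) · d ≡ (x ⊝ m · d) ⊝ (y ⊝ m′ · d)
    regroup = begin
      (x ⊝ y) ⊝ (m -₅ m′) · d              ≡⟨ cong (λ z → (x ⊝ y) ⊝ z) (·-distribʳ m (-₅ m′) d) ⟩
      (x ⊝ y) ⊝ (m · d ⊕ (-₅ m′) · d)      ≡⟨ cong (λ z → (x ⊝ y) ⊝ (m · d ⊕ z)) (·-neg m′ d) ⟩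
      (x ⊝ y) ⊝ (m · d ⊝ m′ · d)           ≡⟨ [x-y]-[u-v]≈[x-u]-[y-v] x y (m · d) (m′ · d) ⟩
      (x ⊝ m · d) ⊝ (y ⊝ m′ · d)           ∎

  0∈Coset⇒≡0 : ∀ {k} → 0G ∈ Coset k → k ≡ 0₅
  0∈Coset⇒≡0 {k} 0∈Ck with ·₅-invertible k
  ... | inj₁ k≡0         = k≡0
  ... | inj₂ (k⁻¹ , k⁻¹k≡1) = ⊥-elim (d∉F (subst (_∈ F) cancel (·-closed k⁻¹ kd∈F)))
    where
    kd∈F : k · d ∈ F
    kd∈F = subst (_∈ F) (trans (cong ⊖_ (identityˡ (⊖ (k · d)))) (⁻¹-involutive (k · d))) (⊖-closed 0∈Ck)
    cancel : k⁻¹ · (k · d) ≡ d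
    cancel = begin
      k⁻¹ · (k · d)   ≡⟨ ·-assoc k⁻¹ k d ⟨
      (k⁻¹ ·₅ k) · d  ≡⟨ cong (_· d) k⁻¹k≡1 ⟩
      1₅ · d          ≡⟨ ·-identity d ⟩
      d               ∎

  Coset-disjoint : ∀ {m m′} → ¬ m ≡ m′ → Disjoint (Coset m) (Coset m′)
  Coset-disjoint {m} {m′} m≢m′ x x∈m x∈m′ =
    m≢m′ (-₅-≡0⇒≡ m m′ (0∈Coset⇒≡0 (subst (_∈ Coset (m -₅ m′)) (inverseʳ x) (Coset-⊝ {m} {m′} x∈m x∈m′))))

  module _ (F-index : HasIndex5 F) where

    card-Coset : ∀ m → card (Coset m) ≡ card F
    card-Coset m = card-⊕ F (⊖ (m · d))

    Coset-cover : ∀ x → ∃[ m ] x ∈ Coset m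
    Coset-cover x = ∈-⋃⁻ Coset (allFin 5) (card-complete (⋃ Coset (allFin 5)) (≤-reflexive full) x)
      where
      full : card {n} (λ _ → true) ≡ card (⋃ Coset (allFin 5))
      full = begin
        card {n} (λ _ → true)       ≡⟨ card-⊤ n ⟩
        5 ^ n                       ≡⟨ F-index ⟨
        5 * card F                  ≡⟨ ∑-cong card-Coset ⟨
        ∑ (λ m → card (Coset m))    ≡⟨ card-⋃-disjoint Coset (allFin 5) (AllPairs.map Coset-disjoint (allFin⁺ 5)) ⟨
        card (⋃ Coset (allFin 5))   ∎

    -- Abstract so that type checking never unfolds the counting argument behind Coset-cover.
    abstract
      label : G n → ℤ₅
      label x = proj₁ (Coset-cover x)

      ∈-Coset-label : ∀ x → x ∈ Coset (label x)
      ∈-Coset-label x = proj₂ (Coset-cover x)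

    label-unique : ∀ {m x} → x ∈ Coset m → label x ≡ m
    label-unique {m} {x} x∈m =
      decidable-stable (label x ≟₅ m) λ ≢m → Coset-disjoint ≢m x (∈-Coset-label x) x∈m

    ∈-Coset : ∀ {m x} → label x ≡ m → x ∈ Coset m
    ∈-Coset {x = x} refl = ∈-Coset-label x

    label-⊝ : ∀ x y → label (x ⊝ y) ≡ label x -₅ label y
    label-⊝ x y = label-unique (Coset-⊝ {label x} {label y} (∈-Coset-label x) (∈-Coset-label y))

    SameCoset⇒label≡ : ∀ {x y} → SameCoset F x y → label x ≡ label y
    SameCoset⇒label≡ {x} {y} x-y∈F =
      -₅-≡0⇒≡ (label x) (label y)
        (trans (sym (label-⊝ x y)) (label-unique (subst T (sym (Coset-0 (x ⊝ y))) x-y∈F)))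

    label≡⇒SameCoset : ∀ {x y} → label x ≡ label y → SameCoset F x y
    label≡⇒SameCoset {x} {y} label≡ = subst T (Coset-0 (x ⊝ y)) (∈-Coset (begin
      label (x ⊝ y)           ≡⟨ label-⊝ x y ⟩
      label x -₅ label y      ≡⟨ cong (λ m → label x -₅ m) label≡ ⟨
      label x -₅ label x      ≡⟨ -₅-inverseʳ (label x) ⟩
      0₅                      ∎))

    Coset⊆A+A : ∀ (A : Subset n) {s t} → card F < card (A ∩ Coset s) + card (A ∩ Coset t) →
      ∀ {y} → y ∈ Coset (s +₅ t) → ∃[ p ] ∃[ q ] (p ∈ A × q ∈ A × p ⊕ q ≡ y)
    Coset⊆A+A A {s} {t} big {y} y∈s+t = sum-of (pigeonhole {P = P} {Q = Q} P∪Q⊆Cs bound)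
      where
      P Q : Subset n
      P = A ∩ Coset s
      Q z = (A ∩ Coset t) (y ⊝ z)
      P∪Q⊆Cs : (P ∪ Q) ⊆ Coset s
      P∪Q⊆Cs z z∈P∪Q with to (T-∨ {P z}) z∈P∪Q
      ... | inj₁ z∈P = proj₂ (to T-∧ z∈P)
      ... | inj₂ z∈Q = ∈-Coset ([s+t]-u≡t⇒u≡s s t (label z) (begin
        (s +₅ t) -₅ label z     ≡⟨ cong (λ m → m -₅ label z) (label-unique {s +₅ t} y∈s+t) ⟨
        label y -₅ label z      ≡⟨ label-⊝ y z ⟨
        label (y ⊝ z)           ≡⟨ label-unique {t} (proj₂ (to T-∧ z∈Q)) ⟩
        t                       ∎))
      bound : card (Coset s) < card P + card Q
      bound = subst₂ _<_ (sym (card-Coset s)) (cong (card P +_) (sym (card-reflect (A ∩ Coset t) y))) big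
      sum-of : ∃[ z ] (z ∈ P × z ∈ Q) → ∃[ p ] ∃[ q ] (p ∈ A × q ∈ A × p ⊕ q ≡ y)
      sum-of (z , z∈P , z∈Q) = z , y ⊝ z , proj₁ (to T-∧ z∈P) , proj₁ (to T-∧ z∈Q) , x∙[y-x]≈y z y

triple : ∀ {A : Set} → A → A → A → Fin 3 → A
triple a b c zero             = a
triple a b c (suc zero)       = b
triple a b c (suc (suc zero)) = c

triple-η : ∀ {A : Set} (f : Fin 3 → A) i → triple (f (# 0)) (f (# 1)) (f (# 2)) i ≡ f i
triple-η f zero             = refl
triple-η f (suc zero)       = refl
triple-η f (suc (suc zero)) = refl

complement : Fin 3 → Fin 3 × Fin 3
complement zero             = # 1 , # 2
complement (suc zero)       = # 0 , # 2
complement (suc (suc zero)) = # 0 , # 1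

sum₃ : (Fin 3 → ℤ₅) → Fin 3 × Fin 3 → Fin 3 → ℤ₅
sum₃ s (i , k) l = (s i +₅ s k) +₅ s l

-- The pair known to be large for index l: the two other indices, or l twice.
pair-for : Bool → Fin 3 → Fin 3 × Fin 3
pair-for true  l = complement l
pair-for false l = l , l

∀-Bool? : ∀ {P : Bool → Set} → (∀ b → Dec (P b)) → Dec (∀ b → P b)
∀-Bool? P? with P? false | P? true
... | yes f | yes t = yes λ { false → f ; true → t }
... | no ¬f | _     = no λ all → ¬f (all false)
... | yes _ | no ¬t = no λ all → ¬t (all true)

three-sums-cover-table : ∀ s₀ s₁ s₂ → ¬ s₀ ≡ s₁ → ¬ s₀ ≡ s₂ → ¬ s₁ ≡ s₂ → ∀ b₀ b₁ b₂ r →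
  ∃[ l ] ∃[ l′ ] sum₃ (triple s₀ s₁ s₂) (pair-for (triple b₀ b₁ b₂ l) l) l′ ≡ r
three-sums-cover-table = from-yes (all? λ s₀ → all? λ s₁ → all? λ s₂ →
  ¬? (s₀ ≟₅ s₁) →-dec ¬? (s₀ ≟₅ s₂) →-dec ¬? (s₁ ≟₅ s₂) →-dec
  ∀-Bool? λ b₀ → ∀-Bool? λ b₁ → ∀-Bool? λ b₂ → all? λ r →
  any? λ l → any? λ l′ → sum₃ (triple s₀ s₁ s₂) (pair-for (triple b₀ b₁ b₂ l) l) l′ ≟₅ r)

three-sums-cover : ∀ (s : Fin 3 → ℤ₅) → ¬ s (# 0) ≡ s (# 1) → ¬ s (# 0) ≡ s (# 2) → ¬ s (# 1) ≡ s (# 2) →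
  (Large : Fin 3 × Fin 3 → Set) → (∀ l → Large (complement l) ⊎ Large (l , l)) →
  ∀ r → ∃[ ik ] ∃[ l ] (Large ik × sum₃ s ik l ≡ r)
three-sums-cover s s₀₁ s₀₂ s₁₂ Large large r = from-table
  (three-sums-cover-table (s (# 0)) (s (# 1)) (s (# 2)) s₀₁ s₀₂ s₁₂ (b (# 0)) (b (# 1)) (b (# 2)) r)
  where
  choice : ∀ l → Large (complement l) ⊎ Large (l , l) → ∃[ b ] Large (pair-for b l)
  choice l (inj₁ large-complement) = true , large-complement
  choice l (inj₂ large-double)     = false , large-double
  b : Fin 3 → Bool
  b l = proj₁ (choice l (large l))
  s′ : Fin 3 → ℤ₅
  s′ = triple (s (# 0)) (s (# 1)) (s (# 2))
  sum₃-η : ∀ ik l → sum₃ s′ ik l ≡ sum₃ s ik l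
  sum₃-η (i , k) l = cong₂ _+₅_ (cong₂ _+₅_ (triple-η s i) (triple-η s k)) (triple-η s l)
  from-table : ∃[ l ] ∃[ l′ ] sum₃ s′ (pair-for (triple (b (# 0)) (b (# 1)) (b (# 2)) l) l) l′ ≡ r →
    ∃[ ik ] ∃[ l ] (Large ik × sum₃ s ik l ≡ r)
  from-table (l , l′ , sum≡r) rewrite triple-η b l =
    pair-for (b l) l , l′ , proj₂ (choice l (large l)) , trans (sym (sum₃-η (pair-for (b l) l) l′)) sum≡r

dense⇒large-pair : ∀ f a b c → 3 * (5 * f) < 10 * (a + b + c) → f < a + b ⊎ f < c + c
dense⇒large-pair f a b c dense with f <? a + b
... | yes f<a+b = inj₁ f<a+b
... | no  f≮a+b = inj₂ (≰⇒> λ c+c≤f → n≮n _ (<-≤-trans dense (begin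
  10 * (a + b + c)             ≡⟨ regroup a b c ⟩
  10 * (a + b) + 5 * (c + c)   ≤⟨ +-mono-≤ (*-monoʳ-≤ 10 (≮⇒≥ f≮a+b)) (*-monoʳ-≤ 5 c+c≤f) ⟩
  10 * f + 5 * f               ≡⟨ fifteen f ⟩
  3 * (5 * f)                  ∎)))
  where
  open ≤-Reasoning
  regroup : ∀ a b c → 10 * (a + b + c) ≡ 10 * (a + b) + 5 * (c + c)
  regroup = solve-∀
  fifteen : ∀ f → 10 * f + 5 * f ≡ 3 * (5 * f)
  fifteen = solve-∀

sum-complement : ∀ (a : Fin 3 → ℕ) l →
  a (proj₁ (complement l)) + a (proj₂ (complement l)) + a l ≡ sum (mapₗ a (allFin 3))
sum-complement a zero             = rearrange₀ (a (# 0)) (a (# 1)) (a (# 2))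
  where
  rearrange₀ : ∀ x y z → y + z + x ≡ x + (y + (z + 0))
  rearrange₀ = solve-∀
sum-complement a (suc zero)       = rearrange₁ (a (# 0)) (a (# 1)) (a (# 2))
  where
  rearrange₁ : ∀ x y z → x + z + y ≡ x + (y + (z + 0))
  rearrange₁ = solve-∀
sum-complement a (suc (suc zero)) = rearrange₂ (a (# 0)) (a (# 1)) (a (# 2))
  where
  rearrange₂ : ∀ x y z → x + y + z ≡ x + (y + (z + 0))
  rearrange₂ = solve-∀

three-cosets⇒3A-full : ∀ {n} (A F : Subset n) → IsSubgroup F → HasIndex5 F →
  (c : Fin 3 → G n) →
  ¬ SameCoset F (c (# 0)) (c (# 1)) → ¬ SameCoset F (c (# 0)) (c (# 2)) → ¬ SameCoset F (c (# 1)) (c (# 2)) →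
  (∀ l → ∃[ a ] (a ∈ A × SameCoset F a (c l))) →
  (∀ a → a ∈ A → ∃[ l ] SameCoset F a (c l)) →
  3 * (5 * card F) < 10 * card A → 3A-full A
three-cosets⇒3A-full {n} A F F-subgroup F-index c c₀≁c₁ c₀≁c₂ c₁≁c₂ meets covered dense x =
  decompose (three-sums-cover s (distinct c₀≁c₁) (distinct c₀≁c₂) (distinct c₁≁c₂) Large large (label F-index x))
  where
  open Cosets F F-subgroup (c (# 0) ⊝ c (# 1)) c₀≁c₁
  open AbelianGroupLemmas (ℤ₅ⁿ n) using ([x-y]∙y≈x)

  s : Fin 3 → ℤ₅
  s l = label F-index (c l)

  distinct : ∀ {i j} → ¬ SameCoset F (c i) (c j) → ¬ s i ≡ s j
  distinct cᵢ≁cⱼ sᵢ≡sⱼ = cᵢ≁cⱼ (label≡⇒SameCoset F-index sᵢ≡sⱼ)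

  slice : Fin 3 → Subset n
  slice l = A ∩ Coset (s l)

  size : Fin 3 → ℕ
  size l = card (slice l)

  Large : Fin 3 × Fin 3 → Set
  Large (i , k) = card F < size i + size k

  A⊆⋃slice : A ⊆ ⋃ slice (allFin 3)
  A⊆⋃slice a a∈A = let l , a∼cₗ = covered a a∈A in
    ∈-⋃⁺ slice (∈-allFin l) (from T-∧ (a∈A , ∈-Coset F-index (SameCoset⇒label≡ F-index a∼cₗ)))

  large : ∀ l → Large (complement l) ⊎ Large (l , l)
  large l = dense⇒large-pair (card F) (size (proj₁ (complement l))) (size (proj₂ (complement l))) (size l)
    (subst (λ t → 3 * (5 * card F) < 10 * t) (sym (sum-complement size l))
      (<-≤-trans dense (*-monoʳ-≤ 10 (≤-trans (card-mono A⊆⋃slice) (card-⋃ slice (allFin 3))))))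

  decompose : ∃[ ik ] ∃[ l ] (Large ik × sum₃ s ik l ≡ label F-index x) →
    ∃[ a₁ ] ∃[ a₂ ] ∃[ a₃ ] (a₁ ∈ A × a₂ ∈ A × a₃ ∈ A × (a₁ ⊕ a₂) ⊕ a₃ ≡ x)
  decompose ((i , k) , l , large-ik , sum≡) =
    let a , a∈A , a∼cₗ = meets l
        p , q , p∈A , q∈A , p+q≡x-a = Coset⊆A+A F-index A {s i} {s k} large-ik (∈-Coset F-index (label-x-a a∼cₗ))
    in  p , q , a , p∈A , q∈A , a∈A , trans (cong (_⊕ a) p+q≡x-a) ([x-y]∙y≈x x a)
    where
    label-x-a : ∀ {a} → SameCoset F a (c l) → label F-index (x ⊝ a) ≡ s i +₅ s k
    label-x-a {a} a∼cₗ = begin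
      label F-index (x ⊝ a)                         ≡⟨ label-⊝ F-index x a ⟩
      (label F-index x -₅ label F-index a)          ≡⟨ cong₂ _-₅_ (sym sum≡) (SameCoset⇒label≡ F-index a∼cₗ) ⟩
      (((s i +₅ s k) +₅ s l) -₅ s l)                ≡⟨ [u+v]-v≡u (s i +₅ s k) (s l) ⟩
      s i +₅ s k                                    ∎
      where open ≡-Reasoning

proposition1 : (n : ℕ) → n ≥ 1 → (A : Subset n) →
    3 * 5 ^ n < 10 * card A →
    ¬ 3A-full A →
    (F : Subset n) → IsSubgroup F → HasIndex5 F →
    ¬ MeetsExactlyThreeCosets F A
proposition1 n _ A dense ¬full F F-subgroup F-index
  (c₁ , c₂ , c₃ , c₁≁c₂ , c₁≁c₃ , c₂≁c₃ , meets₁ , meets₂ , meets₃ , covered) =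
  ¬full (three-cosets⇒3A-full A F F-subgroup F-index (triple c₁ c₂ c₃) c₁≁c₂ c₁≁c₃ c₂≁c₃
           meets covered′ dense′)
  where
  meets : ∀ l → ∃[ a ] (a ∈ A × SameCoset F a (triple c₁ c₂ c₃ l))
  meets zero             = meets₁
  meets (suc zero)       = meets₂
  meets (suc (suc zero)) = meets₃
  covered′ : ∀ a → a ∈ A → ∃[ l ] SameCoset F a (triple c₁ c₂ c₃ l)
  covered′ a a∈A = [ [ (# 0 ,_) , (# 1 ,_) ]′ , (# 2 ,_) ]′ (covered a a∈A)
  dense′ : 3 * (5 * card F) < 10 * card A
  dense′ = subst (λ t → 3 * t < 10 * card A) (sym F-index) dense
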